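{- Let $G$ and $H$ be finite digraphs. Then $\forall$ has a winning strategy in the one-colour Seurat game $\mathbf{G}^1(G,H)$ in each of the following situations: (1) $G$ has exactly one vertex and $H$ has more than one, or vice versa; (2) one of $G,H$ is strongly connected and the other is not; (3) one of $G,H$ is weakly connected and the other is not; (4) one of $G,H$ has an irreflexive vertex (a vertex without a loop) and the other does not; (5) $G$ and $H$ are not isomorphic and each has at most two vertices.
   Context: Digraphs: finite vertex set with edge relation (loops allowed, no multiple edges). A digraph is weakly connected if any two vertices are joined by a path in the symmetric closure of the edge relation, and strongly connected if for any two vertices $u,v$ there are directed paths from $u$ to $v$ and from $v$ to $u$. Seurat game $\mathbf{G}^k(G,H)$: two players $\forall,\exists$, a set $\mathbf{Col}$ of $k$ colours. A position is a pair of functions $g:\mathbf{Col}\to\wp(G)$, $h:\mathbf{Col}\to\wp(H)$, initially all empty. In each of $\omega$ rounds $\forall$ chooses a colour $c$, one of the graphs and a subset of its vertices; $\exists$ then chooses a subset of the other graph; $c$ is then assigned these two sets (erasing its previous use). The palette of a vertex is the set of colours whose set contains it; $P^G$ is the set of vertices of $G$ with palette exactly $P$. $\forall$ wins in round $n$ if at its beginning (C1) some palette $P$ has $P^G$ empty and $P^H$ nonempty or vice versa, or (C2) there are palettes $P_1,P_2$ with an edge from $P_1^G$ to $P_2^G$ but none from $P_1^H$ to $P_2^H$, or vice versa. $\forall$ has a winning strategy if he can guarantee a win in finitely many rounds. -}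

module Defs where

open import Data.Nat using (ℕ; _<_; _≤_)
open import Data.Bool using (Bool; true; false; if_then_else_)
open import Data.Fin using (Fin; _≟_)
open import Data.Fin.Subset using (Subset) renaming (⊥ to ∅)
open import Data.Vec using (lookup; tabulate)
open import Data.Product using (_×_; ∃; ∃-syntax; Σ-syntax)
open import Data.Sum using (_⊎_)
open import Relation.Nullary using (¬_; does)
open import Relation.Binary.PropositionalEquality using (_≡_)
open import Function.Bundles using (_↔_; Inverse)

record Digraph : Set where
  constructor digraph
  field
    V : ℕ
    E : Fin V → Fin V → Bool

open Digraph public

Edge : (G : Digraph) → Fin (V G) → Fin (V G) → Set
Edge G u v = E G u v ≡ true

data Reach (G : Digraph) : Fin (V G) → Fin (V G) → Set where
  here : ∀ {u} → Reach G u u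
  step : ∀ {u w v} → Edge G u w → Reach G w v → Reach G u v

data WReach (G : Digraph) : Fin (V G) → Fin (V G) → Set where
  here : ∀ {u} → WReach G u u
  fwd  : ∀ {u w v} → Edge G u w → WReach G w v → WReach G u v
  bwd  : ∀ {u w v} → Edge G w u → WReach G w v → WReach G u v

StronglyConnected : Digraph → Set
StronglyConnected G = ∀ u v → Reach G u v

WeaklyConnected : Digraph → Set
WeaklyConnected G = ∀ u v → WReach G u v

HasIrreflexiveVertex : Digraph → Set
HasIrreflexiveVertex G = ∃[ v ] ¬ Edge G v v

Isomorphic : Digraph → Digraph → Set
Isomorphic G H =
  Σ[ f ∈ (Fin (V G) ↔ Fin (V H)) ]
    (∀ u v → E G u v ≡ E H (Inverse.to f u) (Inverse.to f v))

OneButNotOther : (Digraph → Set) → Digraph → Digraph → Set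
OneButNotOther P G H = (P G × ¬ P H) ⊎ (P H × ¬ P G)

record Position (k : ℕ) (G H : Digraph) : Set where
  constructor pos
  field
    g : Fin k → Subset (V G)
    h : Fin k → Subset (V H)

open Position public

initial : ∀ {k G H} → Position k G H
initial = pos (λ _ → ∅) (λ _ → ∅)

assign : ∀ {k G H} → Fin k → Subset (V G) → Subset (V H) →
         Position k G H → Position k G H
assign c S T p =
  pos (λ c' → if does (c' ≟ c) then S else g p c')
      (λ c' → if does (c' ≟ c) then T else h p c')

palette : ∀ {k n} → (Fin k → Subset n) → Fin n → Subset k
palette col v = tabulate (λ c → lookup (col c) v)

InClass : ∀ {k n} → (Fin k → Subset n) → Subset k → Fin n → Set
InClass col P v = palette col v ≡ P

NonemptyClass : ∀ {k n} → (Fin k → Subset n) → Subset k → Set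
NonemptyClass col P = ∃[ v ] InClass col P v

EdgeBetween : ∀ {k} (G : Digraph) → (Fin k → Subset (V G)) →
              Subset k → Subset k → Set
EdgeBetween G col P₁ P₂ =
  ∃[ u ] ∃[ v ] (InClass col P₁ u × InClass col P₂ v × Edge G u v)

C1 : ∀ {k G H} → Position k G H → Set
C1 {k} p = ∃[ P ]
  ((¬ NonemptyClass (g p) P × NonemptyClass (h p) P) ⊎
   (NonemptyClass (g p) P × ¬ NonemptyClass (h p) P))

C2 : ∀ {k G H} → Position k G H → Set
C2 {k} {G} {H} p = ∃[ P₁ ] ∃[ P₂ ]
  ((EdgeBetween G (g p) P₁ P₂ × ¬ EdgeBetween H (h p) P₁ P₂) ⊎
   (EdgeBetween H (h p) P₁ P₂ × ¬ EdgeBetween G (g p) P₁ P₂))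

ForallWinsNow : ∀ {k G H} → Position k G H → Set
ForallWinsNow p = C1 p ⊎ C2 p

-- An inhabitant is a well-founded
-- winning strategy tree.
data ForallCanWinFrom {k : ℕ} {G H : Digraph} : Position k G H → Set where
  now   : ∀ {p} → ForallWinsNow p → ForallCanWinFrom p
  playG : ∀ {p} (c : Fin k) (S : Subset (V G)) →
          ((T : Subset (V H)) → ForallCanWinFrom (assign c S T p)) →
          ForallCanWinFrom p
  playH : ∀ {p} (c : Fin k) (T : Subset (V H)) →
          ((S : Subset (V G)) → ForallCanWinFrom (assign c S T p)) →
          ForallCanWinFrom p

ForallWins : ℕ → Digraph → Digraph → Set
ForallWins k G H = ForallCanWinFrom {k} {G} {H} initial

-- With one colour, a move of ∀ is a 2-colouring of one graph, which ∃ must answer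
-- by a 2-colouring of the other realising the same colour classes and the same
-- coloured edge types.  A digraph that is not strongly (weakly) connected has a
-- nonempty proper vertex set left by no edge (no edge in either direction), while
-- in a connected digraph every nonempty proper set is left by one; ∀ colours that
-- set.  A loopless vertex coloured alone carries no coloured loop, whereas with
-- all loops every colour class carries one.  On at most two vertices a colouring
-- by distinct colours can only be answered along a colour-preserving bijection,
-- which, the graphs not being isomorphic, misses some edge.
module Submission where

open import Defs
open import Data.Nat using (_<_; _≤_)
open import Data.Product using (_×_)
open import Data.Sum using (_⊎_)
open import Relation.Nullary using (¬_)
open import Relation.Binary.PropositionalEquality using (_≡_)

open import Level using (Level)
open import Data.Nat using (ℕ; zero; suc; z≤n; s≤s)
open import Data.Bool using (true; false) renaming (_≟_ to _≟ᴮ_)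
open import Data.Fin using (Fin; zero; suc)
open import Data.Fin.Properties using (any?; all?; ¬∀⟶∃¬)
open import Data.Fin.Subset
  using (Subset; Side; inside; outside; _∈_; _∉_; _⊆_; _⊂_; _⊃_; _∪_; ⁅_⁆; Nonempty; Lift)
open import Data.Fin.Subset.Properties using (x∈⁅x⁆; x∈⁅y⁆⇒x≡y; p⊆p∪q; x∈p∪q⁺; x∈p∪q⁻)
open import Data.Fin.Subset.Induction using (⊃-wellFounded; Acc; acc)
open import Data.Fin.Permutation using (transpose)
open import Data.Vec using (_∷_; []; lookup; _[_]=_; here; there)
open import Data.Vec.Properties using ([]=-injective; []=⇒lookup; lookup⇒[]=; ∷-injectiveˡ)
open import Data.Product using (∃; ∃₂; _,_)
open import Data.Sum using (inj₁; inj₂)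
import Data.Sum as Sum
open import Function using (_∘_; id; Injective; Inverse; _↔_)
open import Function.Construct.Identity using (↔-id)
open import Relation.Nullary using (Dec; yes; no; contradiction)
open import Relation.Nullary.Decidable using (map′; _×-dec_; _⊎-dec_; decidable-stable)
open import Relation.Binary using (Rel; Decidable)
open import Relation.Binary.PropositionalEquality using (refl; sym; trans; cong; module ≡-Reasoning)
open import Relation.Binary.Construct.Closure.ReflexiveTransitive using (Star; ε; _◅_; _◅◅_)
open import Relation.Binary.Construct.Closure.Symmetric using (SymClosure; fwd; bwd)

private
  variable
    ℓ : Level
    n : ℕ

-- Subsets as 2-colourings

colour? : (p : Subset n) (v : Fin n) (s : Side) → Dec (p [ v ]= s)
colour? p v s = map′ (lookup⇒[]= v p) []=⇒lookup (lookup p v ≟ᴮ s)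

side : (p : Subset n) (v : Fin n) → v ∈ p ⊎ p [ v ]= outside
side p v with lookup p v in eq
... | true  = inj₁ (lookup⇒[]= v p eq)
... | false = inj₂ (lookup⇒[]= v p eq)

outside⇒∉ : {p : Subset n} {v : Fin n} → p [ v ]= outside → v ∉ p
outside⇒∉ out v∈p with () ← []=-injective v∈p out

coloured : (p : Subset n) (v : Fin n) → p [ v ]= lookup p v
coloured p v = lookup⇒[]= v p refl

Has : Subset n → Side → Set
Has p s = ∃ λ v → p [ v ]= s

has? : (p : Subset n) (s : Side) → Dec (Has p s)
has? p s = any? λ v → colour? p v s

Link : Rel (Fin n) ℓ → Subset n → Side → Side → Set ℓ
Link _⟶_ p s t = ∃₂ λ a b → p [ a ]= s × p [ b ]= t × a ⟶ b

Closed : Rel (Fin n) ℓ → Subset n → Set ℓ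
Closed _⟶_ p = ¬ Link _⟶_ p inside outside

Cut : Rel (Fin n) ℓ → Set ℓ
Cut _⟶_ = ∃ λ q → Nonempty q × Has q outside × Closed _⟶_ q

module _ {_⟶_ : Rel (Fin n) ℓ} where

  star-link : {p : Subset n} {x y : Fin n} →
              Star _⟶_ x y → x ∈ p → p [ y ]= outside → Link _⟶_ p inside outside
  star-link ε x∈p y-out = contradiction x∈p (outside⇒∉ y-out)
  star-link {p = p} (_◅_ {j = w} x⟶w w⟶*y) x∈p y-out with side p w
  ... | inj₁ w∈p  = star-link w⟶*y w∈p y-out
  ... | inj₂ w-out = _ , w , x∈p , w-out , x⟶w

  module _ (_⟶?_ : Decidable _⟶_) where

    link? : ∀ p s t → Dec (Link _⟶_ p s t)
    link? p s t =
      any? λ a → any? λ b → colour? p a s ×-dec colour? p b t ×-dec a ⟶? b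

    close-within : (R : Fin n → Set ℓ) → (∀ {a b} → R a → a ⟶ b → R b) →
                   (p : Subset n) → Acc _⊃_ p → Lift R p →
                   (∀ v → R v) ⊎ ∃ λ q → p ⊆ q × Has q outside × Closed _⟶_ q
    close-within R R-closed p (acc grow) p⊆R with link? p inside outside
    ... | yes (a , b , a∈p , b-out , a⟶b) =
      Sum.map₂ (λ (q , p∪b⊆q , rest) → q , p∪b⊆q ∘ p⊆p∪q ⁅ b ⁆ , rest)
        (close-within R R-closed (p ∪ ⁅ b ⁆) (grow p⊂p∪b) p∪b⊆R)
      where
      p⊂p∪b : p ⊂ p ∪ ⁅ b ⁆
      p⊂p∪b = p⊆p∪q ⁅ b ⁆ , b , x∈p∪q⁺ (inj₂ (x∈⁅x⁆ b)) , outside⇒∉ b-out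
      p∪b⊆R : Lift R (p ∪ ⁅ b ⁆)
      p∪b⊆R x∈p∪b with x∈p∪q⁻ p ⁅ b ⁆ x∈p∪b
      ... | inj₁ x∈p = p⊆R x∈p
      ... | inj₂ x∈b rewrite x∈⁅y⁆⇒x≡y b x∈b = R-closed (p⊆R a∈p) a⟶b
    ... | no closed with has? p outside
    ...   | yes out = inj₂ (p , id , out , closed)
    ...   | no ¬out = inj₁ λ v → p⊆R (everywhere v)
      where
      everywhere : ∀ v → v ∈ p
      everywhere v with side p v
      ... | inj₁ v∈p  = v∈p
      ... | inj₂ v-out = contradiction (v , v-out) ¬out

    reaches-all-or-cut : (u : Fin n) →
      (∀ v → Star _⟶_ u v) ⊎ ∃ λ q → ⁅ u ⁆ ⊆ q × Has q outside × Closed _⟶_ q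
    reaches-all-or-cut u =
      close-within (Star _⟶_ u) (λ r e → r ◅◅ e ◅ ε) ⁅ u ⁆ (⊃-wellFounded ⁅ u ⁆) from-u
      where
      from-u : Lift (Star _⟶_ u) ⁅ u ⁆
      from-u x∈u rewrite x∈⁅y⁆⇒x≡y u x∈u = ε

    reaches-all? : (u : Fin n) → Dec (∀ v → Star _⟶_ u v)
    reaches-all? u with reaches-all-or-cut u
    ... | inj₁ all = yes all
    ... | inj₂ (q , u⊆q , (v , v-out) , closed) =
      no λ all → closed (star-link (all v) (u⊆q (x∈⁅x⁆ u)) v-out)

    disconnected⇒cut : ¬ (∀ u v → Star _⟶_ u v) → Cut _⟶_
    disconnected⇒cut ¬conn with ¬∀⟶∃¬ n _ reaches-all? ¬conn
    ... | u , ¬all with reaches-all-or-cut u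
    ...   | inj₁ all = contradiction all ¬all
    ...   | inj₂ (q , u⊆q , out , closed) = q , (u , u⊆q (x∈⁅x⁆ u)) , out , closed

symClosure? : {_⟶_ : Rel (Fin n) ℓ} → Decidable _⟶_ → Decidable (SymClosure _⟶_)
symClosure? _⟶?_ a b = map′ Sum.[ fwd , bwd ] fwd-or-bwd (a ⟶? b ⊎-dec b ⟶? a)
  where
  fwd-or-bwd : SymClosure _ a b → _ ⊎ _
  fwd-or-bwd (fwd a⟶b) = inj₁ a⟶b
  fwd-or-bwd (bwd b⟶a) = inj₂ b⟶a

module _ {_⟶_ : Rel (Fin n) ℓ} {p : Subset n} {s t : Side} where

  link-sym⁺ : Link _⟶_ p s t ⊎ Link _⟶_ p t s → Link (SymClosure _⟶_) p s t
  link-sym⁺ (inj₁ (a , b , a-s , b-t , a⟶b)) = a , b , a-s , b-t , fwd a⟶b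
  link-sym⁺ (inj₂ (a , b , a-t , b-s , a⟶b)) = b , a , b-s , a-t , bwd a⟶b

  link-sym⁻ : Link (SymClosure _⟶_) p s t → Link _⟶_ p s t ⊎ Link _⟶_ p t s
  link-sym⁻ (a , b , a-s , b-t , fwd a⟶b) = inj₁ (a , b , a-s , b-t , a⟶b)
  link-sym⁻ (a , b , a-s , b-t , bwd b⟶a) = inj₂ (b , a , b-t , a-s , b⟶a)

module _ {G : Digraph} where

  Reach⇒Star : ∀ {u v} → Reach G u v → Star (Edge G) u v
  Reach⇒Star here       = ε
  Reach⇒Star (step e r) = e ◅ Reach⇒Star r

  Star⇒Reach : ∀ {u v} → Star (Edge G) u v → Reach G u v
  Star⇒Reach ε       = here
  Star⇒Reach (e ◅ r) = step e (Star⇒Reach r)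

  WReach⇒Star : ∀ {u v} → WReach G u v → Star (SymClosure (Edge G)) u v
  WReach⇒Star here      = ε
  WReach⇒Star (fwd e r) = fwd e ◅ WReach⇒Star r
  WReach⇒Star (bwd e r) = bwd e ◅ WReach⇒Star r

  Star⇒WReach : ∀ {u v} → Star (SymClosure (Edge G)) u v → WReach G u v
  Star⇒WReach ε           = here
  Star⇒WReach (fwd e ◅ r) = fwd e (Star⇒WReach r)
  Star⇒WReach (bwd e ◅ r) = bwd e (Star⇒WReach r)

edge? : (G : Digraph) → Decidable (Edge G)
edge? G a b = E G a b ≟ᴮ true

private
  variable
    k : ℕ
    G H : Digraph

swap : Position k G H → Position k H G
swap p = pos (h p) (g p)

swap-now : {p : Position k G H} → ForallWinsNow p → ForallWinsNow (swap p)
swap-now (inj₁ (P , inj₁ (¬c , c)))         = inj₁ (P , inj₂ (c , ¬c))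
swap-now (inj₁ (P , inj₂ (c , ¬c)))         = inj₁ (P , inj₁ (¬c , c))
swap-now (inj₂ (P₁ , P₂ , inj₁ (eG , ¬eH))) = inj₂ (P₁ , P₂ , inj₂ (eG , ¬eH))
swap-now (inj₂ (P₁ , P₂ , inj₂ (eH , ¬eG))) = inj₂ (P₁ , P₂ , inj₁ (eH , ¬eG))

swap-wins-from : {p : Position k G H} → ForallCanWinFrom p → ForallCanWinFrom (swap p)
swap-wins-from {p = p} (now w) = now (swap-now {p = p} w)
swap-wins-from (playG c S f)   = playH c S (swap-wins-from ∘ f)
swap-wins-from (playH c T f)   = playG c T (swap-wins-from ∘ f)

swap-wins : ForallWins k G H → ForallWins k H G
swap-wins = swap-wins-from

-- For a single colour the palette of v is the one-element vector of its side.
module _ {m : ℕ} (col : Fin 1 → Subset m) {s : Side} where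

  has⇒class : Has (col zero) s → NonemptyClass col (s ∷ [])
  has⇒class (v , v-s) = v , cong (_∷ []) ([]=⇒lookup v-s)

  class⇒has : NonemptyClass col (s ∷ []) → Has (col zero) s
  class⇒has (v , v∈P) = v , lookup⇒[]= v (col zero) (∷-injectiveˡ v∈P)

module _ {D : Digraph} (col : Fin 1 → Subset (V D)) {s t : Side} where

  link⇒edgeBetween : Link (Edge D) (col zero) s t → EdgeBetween D col (s ∷ []) (t ∷ [])
  link⇒edgeBetween (a , b , a-s , b-t , e) =
    a , b , cong (_∷ []) ([]=⇒lookup a-s) , cong (_∷ []) ([]=⇒lookup b-t) , e

  edgeBetween⇒link : EdgeBetween D col (s ∷ []) (t ∷ []) → Link (Edge D) (col zero) s t
  edgeBetween⇒link (a , b , a∈P , b∈Q , e) =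
    a , b , lookup⇒[]= a (col zero) (∷-injectiveˡ a∈P) ,
    lookup⇒[]= b (col zero) (∷-injectiveˡ b∈Q) , e

module _ (p : Position 1 G H) {s : Side} where

  class-only-in-G : Has (g p zero) s → ¬ Has (h p zero) s → ForallWinsNow p
  class-only-in-G has ¬has = inj₁ (s ∷ [] , inj₂ (has⇒class (g p) has , ¬has ∘ class⇒has (h p)))

  class-only-in-H : ¬ Has (g p zero) s → Has (h p zero) s → ForallWinsNow p
  class-only-in-H ¬has has = inj₁ (s ∷ [] , inj₁ (¬has ∘ class⇒has (g p) , has⇒class (h p) has))

module _ (p : Position 1 G H) {s t : Side} where

  edge-only-in-G : Link (Edge G) (g p zero) s t → ¬ Link (Edge H) (h p zero) s t →
                   ForallWinsNow p
  edge-only-in-G l ¬l =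
    inj₂ (s ∷ [] , t ∷ [] , inj₁ (link⇒edgeBetween (g p) l , ¬l ∘ edgeBetween⇒link (h p)))

  edge-only-in-H : ¬ Link (Edge G) (g p zero) s t → Link (Edge H) (h p zero) s t →
                   ForallWinsNow p
  edge-only-in-H ¬l l =
    inj₂ (s ∷ [] , t ∷ [] , inj₂ (link⇒edgeBetween (h p) l , ¬l ∘ edgeBetween⇒link (g p)))

round : Subset (V G) → Subset (V H) → Position 1 G H
round S T = assign zero S T initial

¬∀₂⟶∃₂¬ : ∀ {m n} {P : Fin m → Fin n → Set ℓ} → (∀ i j → Dec (P i j)) →
           ¬ (∀ i j → P i j) → ∃₂ λ i j → ¬ P i j
¬∀₂⟶∃₂¬ {m = m} {n} P? ¬∀
  with i , ¬∀j ← ¬∀⟶∃¬ m _ (λ i → all? (P? i)) ¬∀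
  with j , ¬Pij ← ¬∀⟶∃¬ n _ (P? i) ¬∀j
  = i , j , ¬Pij

-- If the colouring S distinguishes all vertices, a colour-preserving bijection
-- is the only possible match, so every edge it fails to preserve is a C2 witness.
module _ {G H : Digraph} (σ : Fin (V G) ↔ Fin (V H)) (S : Subset (V G)) (T : Subset (V H))
         (S-injective : Injective _≡_ _≡_ (lookup S))
         (σ-preserves : ∀ v → lookup T (Inverse.to σ v) ≡ lookup S v) where
  open Inverse σ using (to; from; strictlyInverseˡ)
  open ≡-Reasoning

  coloured-like⇒image : ∀ {a i} → T [ a ]= lookup S i → a ≡ to i
  coloured-like⇒image {a} {i} a-col = begin
    a            ≡⟨ sym (strictlyInverseˡ a) ⟩
    to (from a)  ≡⟨ cong to (S-injective same-colour) ⟩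
    to i         ∎
    where
    same-colour : lookup S (from a) ≡ lookup S i
    same-colour = begin
      lookup S (from a)       ≡⟨ sym (σ-preserves (from a)) ⟩
      lookup T (to (from a))  ≡⟨ cong (lookup T) (strictlyInverseˡ a) ⟩
      lookup T a              ≡⟨ []=⇒lookup a-col ⟩
      lookup S i              ∎

  wins-unless-edge-preserving : ¬ (∀ u v → E G u v ≡ E H (to u) (to v)) →
                                ForallWinsNow (round S T)
  wins-unless-edge-preserving ¬preserving
    with i , j , differ ← ¬∀₂⟶∃₂¬ (λ u v → E G u v ≟ᴮ E H (to u) (to v)) ¬preserving
    with E G i j in eG | E H (to i) (to j) in eH
  ... | true  | true  = contradiction refl differ
  ... | false | false = contradiction refl differ
  ... | true  | false = edge-only-in-G (round S T) (i , j , coloured S i , coloured S j , eG) no-edge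
    where
    no-edge : ¬ Link (Edge H) T (lookup S i) (lookup S j)
    no-edge (a , b , a-col , b-col , e)
      with refl ← coloured-like⇒image a-col | refl ← coloured-like⇒image b-col
      with () ← trans (sym e) eH
  ... | false | true  = edge-only-in-H (round S T) no-edge (to i , to j , T-col i , T-col j , eH)
    where
    T-col : ∀ v → T [ to v ]= lookup S v
    T-col v = lookup⇒[]= (to v) T (σ-preserves v)
    no-edge : ¬ Link (Edge G) S (lookup S i) (lookup S j)
    no-edge (a , b , a-col , b-col , e)
      with refl ← S-injective ([]=⇒lookup a-col) | refl ← S-injective ([]=⇒lookup b-col)
      with () ← trans (sym e) eG

-- ∃ can only answer a properly 2-coloured T by a properly 2-coloured S.
proper-colouring-wins : ∀ {G H} (T : Subset (V H)) → Nonempty T → Has T outside →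
  (∀ S → Nonempty S → Has S outside → ForallWinsNow (round {G} S T)) → ForallWins 1 G H
proper-colouring-wins {G} {H} T T-in T-out respond = playH zero T λ S → now (answer S)
  where
  answer : (S : Subset (V G)) → ForallWinsNow (round S T)
  answer S with has? S inside | has? S outside
  ... | no ¬in   | _         = class-only-in-H (round S T) ¬in T-in
  ... | yes _    | no ¬out   = class-only-in-H (round S T) ¬out T-out
  ... | yes S-in | yes S-out = respond S S-in S-out

single-vs-many : V G ≡ 1 → 1 < V H → ForallWins 1 G H
single-vs-many {digraph _ _} {digraph (suc (suc _)) _} refl (s≤s (s≤s _)) =
  proper-colouring-wins ⁅ zero ⁆ (zero , here) (suc zero , there here)
    λ { S (zero , in-S) (zero , out-S) → contradiction in-S (outside⇒∉ out-S) }

strongly-connected-vs-not : StronglyConnected G → ¬ StronglyConnected H → ForallWins 1 G H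
strongly-connected-vs-not {G} {H} scG ¬scH
  with T , T-in , T-out , T-closed ← disconnected⇒cut (edge? H)
                                        (λ conn → ¬scH λ u v → Star⇒Reach (conn u v))
  = proper-colouring-wins T T-in T-out λ S (x , x∈S) (y , y-out) →
      edge-only-in-G (round S T) (star-link (Reach⇒Star (scG x y)) x∈S y-out) T-closed

weakly-connected-vs-not : WeaklyConnected G → ¬ WeaklyConnected H → ForallWins 1 G H
weakly-connected-vs-not {G} {H} wcG ¬wcH
  with T , T-in , T-out , T-closed ← disconnected⇒cut (symClosure? (edge? H))
                                        (λ conn → ¬wcH λ u v → Star⇒WReach (conn u v))
  = proper-colouring-wins T T-in T-out respond
  where
  respond : (S : Subset (V G)) → Nonempty S → Has S outside → ForallWinsNow (round S T)
  respond S (x , x∈S) (y , y-out) with link-sym⁻ (star-link (WReach⇒Star (wcG x y)) x∈S y-out)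
  ... | inj₁ out-edge = edge-only-in-G (round S T) out-edge (T-closed ∘ link-sym⁺ ∘ inj₁)
  ... | inj₂ in-edge  = edge-only-in-G (round S T) in-edge (T-closed ∘ link-sym⁺ ∘ inj₂)

loopless-vs-not : HasIrreflexiveVertex G → ¬ HasIrreflexiveVertex H → ForallWins 1 G H
loopless-vs-not {G} {H} (v , ¬loop) ¬loopless = playG zero ⁅ v ⁆ λ T → now (answer T)
  where
  loop : ∀ w → Edge H w w
  loop w = decidable-stable (edge? H w w) λ ¬e → ¬loopless (w , ¬e)

  no-edge-in-⁅v⁆ : ¬ Link (Edge G) ⁅ v ⁆ inside inside
  no-edge-in-⁅v⁆ (a , b , a∈ , b∈ , e)
    with refl ← x∈⁅y⁆⇒x≡y v a∈ | refl ← x∈⁅y⁆⇒x≡y v b∈ = ¬loop e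

  answer : (T : Subset (V H)) → ForallWinsNow (round ⁅ v ⁆ T)
  answer T with has? T inside
  ... | no ¬in        = class-only-in-G (round ⁅ v ⁆ T) (v , x∈⁅x⁆ v) ¬in
  ... | yes (w , w∈T) =
    edge-only-in-H (round ⁅ v ⁆ T) no-edge-in-⁅v⁆ (w , w , w∈T , w∈T , loop w)

empty-vs-nonempty : V G ≡ 0 → 0 < V H → ForallWins 1 G H
empty-vs-nonempty {digraph _ _} {digraph (suc _) _} refl _ =
  now (class-only-in-H initial (λ { (() , _) }) (zero , here))

small-nonisomorphic : (G H : Digraph) → ¬ Isomorphic G H → V G ≤ 2 → V H ≤ 2 →
                      ForallWins 1 G H
small-nonisomorphic (digraph 0 _) (digraph 0 _) ¬iso _ _ = contradiction (↔-id _ , λ ()) ¬iso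
small-nonisomorphic (digraph 0 _) (digraph (suc _) _) _ _ _ = empty-vs-nonempty refl (s≤s z≤n)
small-nonisomorphic (digraph (suc _) _) (digraph 0 _) _ _ _ = swap-wins (empty-vs-nonempty refl (s≤s z≤n))
small-nonisomorphic G@(digraph 1 _) H@(digraph 1 _) ¬iso _ _ = playG zero ⁅ zero ⁆ λ T → now (answer T)
  where
  answer : (T : Subset 1) → ForallWinsNow (round ⁅ zero ⁆ T)
  answer T@(inside ∷ [])  =
    wins-unless-edge-preserving {G} {H} (↔-id _) ⁅ zero ⁆ T (λ { {zero} {zero} _ → refl })
      (λ { zero → refl }) (¬iso ∘ (↔-id _ ,_))
  answer T@(outside ∷ []) = class-only-in-G (round ⁅ zero ⁆ T) (zero , here) λ { (zero , ()) }
small-nonisomorphic (digraph 1 _) (digraph 2 _) _ _ _ = single-vs-many refl (s≤s (s≤s z≤n))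
small-nonisomorphic (digraph 2 _) (digraph 1 _) _ _ _ = swap-wins (single-vs-many refl (s≤s (s≤s z≤n)))
small-nonisomorphic G@(digraph 2 _) H@(digraph 2 _) ¬iso _ _ = playG zero ⁅ zero ⁆ λ T → now (answer T)
  where
  S-injective : Injective _≡_ _≡_ (lookup {n = 2} ⁅ zero ⁆)
  S-injective {zero}     {zero}     _ = refl
  S-injective {zero}     {suc zero} ()
  S-injective {suc zero} {zero}     ()
  S-injective {suc zero} {suc zero} _ = refl

  along : (σ : Fin 2 ↔ Fin 2) (T : Subset 2) →
          (∀ v → lookup T (Inverse.to σ v) ≡ lookup ⁅ zero ⁆ v) → ForallWinsNow (round ⁅ zero ⁆ T)
  along σ T preserves =
    wins-unless-edge-preserving {G} {H} σ ⁅ zero ⁆ T S-injective preserves (¬iso ∘ (σ ,_))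

  answer : (T : Subset 2) → ForallWinsNow (round ⁅ zero ⁆ T)
  answer T@(inside  ∷ outside ∷ []) = along (↔-id _) T λ { zero → refl ; (suc zero) → refl }
  answer T@(outside ∷ inside  ∷ []) = along (transpose zero (suc zero)) T
                                        λ { zero → refl ; (suc zero) → refl }
  answer T@(inside  ∷ inside  ∷ []) = class-only-in-G (round ⁅ zero ⁆ T) (suc zero , there here)
                                        λ { (zero , ()) ; (suc zero , there ()) }
  answer T@(outside ∷ outside ∷ []) = class-only-in-G (round ⁅ zero ⁆ T) (zero , here)
                                        λ { (zero , ()) ; (suc zero , there ()) }
small-nonisomorphic (digraph (suc (suc (suc _))) _) _ _ (s≤s (s≤s ())) _
small-nonisomorphic _ (digraph (suc (suc (suc _))) _) _ _ (s≤s (s≤s ()))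

by-symmetry : (A : Digraph → Digraph → Set) → (∀ {G H} → A G H → ForallWins k G H) →
              A G H ⊎ A H G → ForallWins k G H
by-symmetry _ win (inj₁ a) = win a
by-symmetry _ win (inj₂ a) = swap-wins (win a)

one-but-not-other : (P : Digraph → Set) → (∀ {G H} → P G → ¬ P H → ForallWins k G H) →
                    OneButNotOther P G H → ForallWins k G H
one-but-not-other P win = by-symmetry (λ G H → P G × ¬ P H) λ (p , ¬p) → win p ¬p

proposition3p4 : (G H : Digraph) →
    (((V G ≡ 1 × 1 < V H) ⊎ (V H ≡ 1 × 1 < V G)) → ForallWins 1 G H)
    × (OneButNotOther StronglyConnected G H → ForallWins 1 G H)
    × (OneButNotOther WeaklyConnected G H → ForallWins 1 G H)
    × (OneButNotOther HasIrreflexiveVertex G H → ForallWins 1 G H)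
    × ((¬ Isomorphic G H × V G ≤ 2 × V H ≤ 2) → ForallWins 1 G H)
proposition3p4 G H =
    by-symmetry (λ G H → V G ≡ 1 × 1 < V H) (λ (one , many) → single-vs-many one many)
  , one-but-not-other StronglyConnected strongly-connected-vs-not
  , one-but-not-other WeaklyConnected weakly-connected-vs-not
  , one-but-not-other HasIrreflexiveVertex loopless-vs-not
  , λ (¬iso , G≤2 , H≤2) → small-nonisomorphic G H ¬iso G≤2 H≤2
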